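{- Let $n\ge 1$ and let $\mathscr{M}_n$ be the monoid of ordered score sheets of a round-robin tournament between $n$ teams $T_1,\dots,T_n$ (see context). For $1\le i\le n$, let $B^{(i)}$ be the set of score sheets $S=(g_{kj})_{k\neq j}\in\mathscr{M}_n$ such that each of the teams $T_1,\dots,T_i$ has scored exactly one goal in total (i.e. for each $k\le i$ there is exactly one $j\neq k$ with $g_{kj}=1$ and all other $g_{kj'}=0$), and the teams $T_{i+1},\dots,T_n$ have scored no goals at all. Then the Hilbert basis of $\mathscr{M}_n$ is $\bigcup_{i=1}^n B^{(i)}$, and \[ \#\mathrm{HB}(\mathscr{M}_n)=\sum_{i=1}^n (n-1)^{i}. \]
   Context: A score sheet of a round-robin tournament between $n$ teams is a family $S=(g_{ij})_{1\le i\neq j\le n}$ of nonnegative integers ($g_{ij}$ is the number of goals team $T_i$ scored against $T_j$); score sheets are identified with elements of $\mathbb{Z}_{\ge 0}^{n^2-n}$ and added entrywise. Let $g_i=\sum_{j\neq i} g_{ij}$. A score sheet is ordered if $g_1\ge g_2\ge\cdots\ge g_n$; the ordered score sheets form a submonoid $\mathscr{M}_n$ of $\mathbb{Z}_{\ge0}^{n^2-n}$. An element $x\neq 0$ of a positive affine monoid $M$ is irreducible if $x=y+z$ with $y,z\in M$ implies $y=0$ or $z=0$; the Hilbert basis $\mathrm{HB}(M)$ is the set of irreducible elements (the unique minimal generating set). -}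

module Defs where

open import Data.Nat using (ℕ; zero; suc; _+_; _≤_; _<_; _∸_; _^_)
open import Data.Fin using (Fin; toℕ)
import Data.Fin as F
open import Data.Vec using (Vec; lookup; zipWith; replicate)
import Data.Vec as V
open import Data.List using (List; map; upTo)
open import Data.Nat.ListAction using (sum)
open import Data.Product using (Σ; ∃; ∃-syntax; _×_; _,_)
open import Data.Sum using (_⊎_)
open import Relation.Binary.PropositionalEquality using (_≡_; _≢_)
open import Relation.Nullary using (¬_)

-- A score sheet for n teams: an n×n matrix of naturals; entry (i , j) is
-- g_ij, the goals team i scored against team j. Diagonal entries are
-- required to be 0 (see `IsSheet`), so sheets correspond bijectively to
-- elements of ℕ^(n²-n).
Sheet : ℕ → Set
Sheet n = Vec (Vec ℕ n) n

entry : ∀ {n} → Sheet n → Fin n → Fin n → ℕ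
entry S i j = lookup (lookup S i) j

_⊕_ : ∀ {n} → Sheet n → Sheet n → Sheet n
S ⊕ T = zipWith (zipWith _+_) S T

𝟎 : ∀ {n} → Sheet n
𝟎 {n} = replicate n (replicate n 0)

IsSheet : ∀ {n} → Sheet n → Set
IsSheet {n} S = ∀ (i : Fin n) → entry S i i ≡ 0

goals : ∀ {n} → Sheet n → Fin n → ℕ
goals S i = V.sum (lookup S i)

Ordered : ∀ {n} → Sheet n → Set
Ordered {n} S = ∀ (i j : Fin n) → toℕ i ≤ toℕ j → goals S j ≤ goals S i

InM : ∀ {n} → Sheet n → Set
InM S = IsSheet S × Ordered S

-- irreducible elements of 𝓜_n (= elements of the Hilbert basis)
InHB : ∀ {n} → Sheet n → Set
InHB {n} x = InM x × x ≢ 𝟎 ×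
  (∀ (y z : Sheet n) → InM y → InM z → x ≡ y ⊕ z → y ≡ 𝟎 ⊎ z ≡ 𝟎)

-- B^(i) (i a natural number, 1 ≤ i ≤ n in use): teams T_1..T_i (0-based
-- indices k with toℕ k < i) scored exactly one goal in total, i.e. exactly
-- one entry g_kj (j ≠ k) equals 1 and all others are 0; teams T_{i+1}..T_n
-- scored no goals at all.
InB : ∀ {n} → ℕ → Sheet n → Set
InB {n} i S = InM S ×
  (∀ (k : Fin n) → toℕ k < i →
     ∃[ j ] (j ≢ k × entry S k j ≡ 1 × (∀ (j′ : Fin n) → j′ ≢ j → entry S k j′ ≡ 0))) ×
  (∀ (k : Fin n) → i ≤ toℕ k → ∀ (j : Fin n) → entry S k j ≡ 0)

hbCount : ℕ → ℕ
hbCount n = sum (map (λ i → (n ∸ 1) ^ suc i) (upTo n))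

module Submission where

-- An ordered sheet in which T₁ scored exactly one goal is irreducible: in a
-- decomposition y ⊕ z one summand gives T₁ no goal, and since T₁ scores most,
-- that summand is 𝟎. Conversely, split every row of x into its first goal and
-- the remaining ones. The team totals become min(gᵢ, 1) and gᵢ − 1, both
-- monotone in gᵢ, so both parts are ordered sheets; if x is irreducible the
-- remainder is 𝟎, so every team scored at most one goal, and by ordering the
-- scoring teams are T₁, …, Tᵢ. Finally B^(i) is a product over the rows: each of
-- T₁, …, Tᵢ picks one of its n − 1 opponents, giving (n − 1)^i sheets.

open import Defs
open import Algebra.Properties.CommutativeSemigroup using (interchange)
open import Data.Nat using (ℕ; zero; suc; _+_; _*_; _≤_; _<_; _^_; _⊓_; _<?_; pred; z≤n; s≤s)
open import Data.Nat.Properties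
  using (+-commutativeSemigroup; +-identityʳ; m+n≡0⇒m≡0; m+n≡0⇒n≡0; n≤0⇒n≡0; ⊓-zeroʳ; ⊓-monoˡ-≤; pred-mono-≤;
         suc-injective; ≤-reflexive; <⇒≱; ≮⇒≥; ≤-<-trans; <-≤-trans)
open import Data.Fin using (Fin; toℕ; _≟_; punchIn; punchOut; fromℕ<) renaming (zero to fzero; suc to fsuc)
open import Data.Fin.Properties using (punchIn-injective; punchInᵢ≢i; punchIn-punchOut; toℕ-fromℕ<)
open import Data.Vec using (Vec; []; _∷_; lookup; zipWith; replicate; _[_]≔_)
import Data.Vec as V
open import Data.Vec.Properties using (∷-injective; zipWith-identityʳ; lookup-zipWith; lookup-map; lookup-replicate; lookup∘update; lookup∘update′)
open import Data.Vec.Relation.Binary.Pointwise.Extensional using (ext; Pointwise-≡⇒≡)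
open import Data.List using (List; []; _∷_; [_]; length; map; concat; upTo; cartesianProductWith)
import Data.List as List
open import Data.List.Properties using (length-++; length-map; length-tabulate; map-∘; map-cong-local; map-upTo)
open import Data.List.Membership.Propositional using (_∈_)
open import Data.List.Membership.Propositional.Properties
  using (∈-cartesianProductWith⁺; ∈-cartesianProductWith⁻; ∈-tabulate⁺; ∈-tabulate⁻; ∈-map⁺; ∈-map⁻;
         ∈-concat⁺′; ∈-concat⁻′; ∈-upTo⁺; ∈-upTo⁻)
open import Data.List.Relation.Unary.Any using (here)
import Data.List.Relation.Unary.All as All
import Data.List.Relation.Unary.All.Properties as All
import Data.List.Relation.Unary.AllPairs as AllPairs
import Data.List.Relation.Unary.AllPairs.Properties as AllPairs
open import Data.List.Relation.Unary.Unique.Propositional using (Unique)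
open import Data.List.Relation.Unary.Unique.Propositional.Properties using (cartesianProductWith⁺; tabulate⁺; concat⁺)
open import Data.Nat.ListAction using (sum; product)
open import Data.Product using (Σ; ∃-syntax; _×_; _,_)
open import Data.Sum using (_⊎_; inj₁; inj₂)
import Data.Sum as Sum
open import Data.Empty using (⊥; ⊥-elim)
open import Function using (_∘_)
open import Relation.Nullary using (¬_; yes; no)
open import Function.Bundles using (_⇔_; mk⇔; Equivalence)
import Function.Properties.Equivalence as ⇔
open import Relation.Binary.PropositionalEquality using (_≡_; _≢_; refl; sym; trans; cong; cong₂; subst; subst₂; module ≡-Reasoning)

open ≡-Reasoning

zeros : ∀ {n} → Vec ℕ n
zeros = replicate _ 0

unit : ∀ {n} → Fin n → Vec ℕ n
unit j = zeros [ j ]≔ 1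

lookup-unit : ∀ {n} (j : Fin n) → lookup (unit j) j ≡ 1
lookup-unit j = lookup∘update j zeros 1

lookup-unit-≢ : ∀ {n} {i j : Fin n} → i ≢ j → lookup (unit j) i ≡ 0
lookup-unit-≢ {i = i} i≢j = trans (lookup∘update′ i≢j zeros 1) (lookup-replicate i 0)

unit-injective : ∀ {n} {i j : Fin n} → unit i ≡ unit j → i ≡ j
unit-injective {i = fzero}  {fzero}  _  = refl
unit-injective {i = fsuc i} {fsuc j} eq = cong fsuc (unit-injective (cong V.tail eq))

sum-zeros : ∀ n → V.sum (zeros {n}) ≡ 0
sum-zeros zero    = refl
sum-zeros (suc n) = sum-zeros n

sum-unit : ∀ {n} (j : Fin n) → V.sum (unit j) ≡ 1
sum-unit {suc n} fzero = cong suc (sum-zeros n)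
sum-unit (fsuc j)      = sum-unit j

sum≡0⇒≡zeros : ∀ {n} (r : Vec ℕ n) → V.sum r ≡ 0 → r ≡ zeros
sum≡0⇒≡zeros []      _  = refl
sum≡0⇒≡zeros (x ∷ r) eq rewrite m+n≡0⇒m≡0 x eq = cong (0 ∷_) (sum≡0⇒≡zeros r (m+n≡0⇒n≡0 x eq))

≡unit : ∀ {n} {r : Vec ℕ n} (j : Fin n) → lookup r j ≡ 1 → (∀ j′ → j′ ≢ j → lookup r j′ ≡ 0) → r ≡ unit j
≡unit {r = r} j r-j≡1 others≡0 = Pointwise-≡⇒≡ (ext agree)
  where
  agree : ∀ j′ → lookup r j′ ≡ lookup (unit j) j′
  agree j′ with j′ ≟ j
  ... | yes refl  = trans r-j≡1 (sym (lookup-unit j))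
  ... | no j′≢j   = trans (others≡0 j′ j′≢j) (sym (lookup-unit-≢ j′≢j))

≡zeros : ∀ {n} {r : Vec ℕ n} → (∀ j → lookup r j ≡ 0) → r ≡ zeros
≡zeros all≡0 = Pointwise-≡⇒≡ (ext λ j → trans (all≡0 j) (sym (lookup-replicate j 0)))

sum-zipWith-+ : ∀ {n} (u w : Vec ℕ n) → V.sum (zipWith _+_ u w) ≡ V.sum u + V.sum w
sum-zipWith-+ []      []      = refl
sum-zipWith-+ (a ∷ u) (b ∷ w) = begin
  (a + b) + V.sum (zipWith _+_ u w)  ≡⟨ cong ((a + b) +_) (sum-zipWith-+ u w) ⟩
  (a + b) + (V.sum u + V.sum w)      ≡⟨ interchange +-commutativeSemigroup a b (V.sum u) (V.sum w) ⟩
  (a + V.sum u) + (b + V.sum w)      ∎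

firstGoal : ∀ {n} → Vec ℕ n → Vec ℕ n
firstGoal []          = []
firstGoal (zero  ∷ r) = 0 ∷ firstGoal r
firstGoal (suc _ ∷ r) = 1 ∷ zeros

otherGoals : ∀ {n} → Vec ℕ n → Vec ℕ n
otherGoals []          = []
otherGoals (zero  ∷ r) = 0 ∷ otherGoals r
otherGoals (suc a ∷ r) = a ∷ r

firstGoal+otherGoals : ∀ {n} (r : Vec ℕ n) → zipWith _+_ (firstGoal r) (otherGoals r) ≡ r
firstGoal+otherGoals []          = refl
firstGoal+otherGoals (zero  ∷ r) = cong (0 ∷_) (firstGoal+otherGoals r)
firstGoal+otherGoals (suc a ∷ r) = cong (suc a ∷_) (zeros+r≡r r)
  where
  zeros+r≡r : ∀ {n} (r : Vec ℕ n) → zipWith _+_ zeros r ≡ r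
  zeros+r≡r []      = refl
  zeros+r≡r (x ∷ r) = cong (x ∷_) (zeros+r≡r r)

sum-firstGoal : ∀ {n} (r : Vec ℕ n) → V.sum (firstGoal r) ≡ V.sum r ⊓ 1
sum-firstGoal []          = refl
sum-firstGoal (zero  ∷ r) = sum-firstGoal r
sum-firstGoal {suc n} (suc a ∷ r) = cong suc (trans (sum-zeros n) (sym (⊓-zeroʳ (a + V.sum r))))

sum-otherGoals : ∀ {n} (r : Vec ℕ n) → V.sum (otherGoals r) ≡ pred (V.sum r)
sum-otherGoals []          = refl
sum-otherGoals (zero  ∷ r) = sum-otherGoals r
sum-otherGoals (suc a ∷ r) = refl

firstGoal-unit : ∀ {n} (r : Vec ℕ n) → V.sum r ≢ 0 → ∃[ j ] firstGoal r ≡ unit j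
firstGoal-unit []          r≢0 = ⊥-elim (r≢0 refl)
firstGoal-unit (zero  ∷ r) r≢0 with firstGoal-unit r r≢0
... | j , eq = fsuc j , cong (0 ∷_) eq
firstGoal-unit (suc a ∷ r) _   = fzero , refl

lookup-⊕ : ∀ {n} (S T : Sheet n) i → lookup (S ⊕ T) i ≡ zipWith _+_ (lookup S i) (lookup T i)
lookup-⊕ S T i = lookup-zipWith (zipWith _+_) i S T

entry-⊕ : ∀ {n} (S T : Sheet n) i j → entry (S ⊕ T) i j ≡ entry S i j + entry T i j
entry-⊕ S T i j = trans (cong (λ r → lookup r j) (lookup-⊕ S T i)) (lookup-zipWith _+_ j (lookup S i) (lookup T i))

goals-⊕ : ∀ {n} (S T : Sheet n) i → goals (S ⊕ T) i ≡ goals S i + goals T i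
goals-⊕ S T i = trans (cong V.sum (lookup-⊕ S T i)) (sum-zipWith-+ (lookup S i) (lookup T i))

lookup-𝟎 : ∀ {n} (i : Fin n) → lookup (𝟎 {n}) i ≡ zeros
lookup-𝟎 i = lookup-replicate i zeros

goals-𝟎 : ∀ {n} (i : Fin n) → goals (𝟎 {n}) i ≡ 0
goals-𝟎 {n} i = trans (cong V.sum (lookup-𝟎 i)) (sum-zeros n)

goals≡0⇒≡𝟎 : ∀ {n} (S : Sheet n) → (∀ i → goals S i ≡ 0) → S ≡ 𝟎
goals≡0⇒≡𝟎 S h = Pointwise-≡⇒≡ (ext λ i → trans (sum≡0⇒≡zeros (lookup S i) (h i)) (sym (lookup-𝟎 i)))

Ordered∧goals₀≡0⇒≡𝟎 : ∀ {m} {S : Sheet (suc m)} → Ordered S → goals S fzero ≡ 0 → S ≡ 𝟎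
Ordered∧goals₀≡0⇒≡𝟎 {S = S} ord g₀≡0 =
  goals≡0⇒≡𝟎 S λ i → n≤0⇒n≡0 (subst (goals S i ≤_) g₀≡0 (ord fzero i z≤n))

IsSheet-⊕⁻ˡ : ∀ {n} (S T : Sheet n) → IsSheet (S ⊕ T) → IsSheet S
IsSheet-⊕⁻ˡ S T diag i = m+n≡0⇒m≡0 (entry S i i) (trans (sym (entry-⊕ S T i i)) (diag i))

IsSheet-⊕⁻ʳ : ∀ {n} (S T : Sheet n) → IsSheet (S ⊕ T) → IsSheet T
IsSheet-⊕⁻ʳ S T diag i = m+n≡0⇒n≡0 (entry S i i) (trans (sym (entry-⊕ S T i i)) (diag i))

Ordered-monotone : ∀ {n} (S T : Sheet n) (f : ℕ → ℕ) → (∀ {a b} → a ≤ b → f a ≤ f b) →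
                   (∀ i → goals T i ≡ f (goals S i)) → Ordered S → Ordered T
Ordered-monotone _ _ f mono goals-T ord i j i≤j =
  subst₂ _≤_ (sym (goals-T j)) (sym (goals-T i)) (mono (ord i j i≤j))

m+n≡1⇒m≡0⊎n≡0 : ∀ m n → m + n ≡ 1 → m ≡ 0 ⊎ n ≡ 0
m+n≡1⇒m≡0⊎n≡0 zero    _ _  = inj₁ refl
m+n≡1⇒m≡0⊎n≡0 (suc m) n eq = inj₂ (m+n≡0⇒n≡0 m (suc-injective eq))

goals₀≡1⇒InHB : ∀ {m} {S : Sheet (suc m)} → InM S → goals S fzero ≡ 1 → InHB S
goals₀≡1⇒InHB {m} {S} inM g₀≡1 = inM , S≢𝟎 , irreducible
  where
  S≢𝟎 : S ≢ 𝟎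
  S≢𝟎 S≡𝟎 with trans (sym g₀≡1) (trans (cong (λ T → goals T fzero) S≡𝟎) (goals-𝟎 {suc m} fzero))
  ... | ()
  irreducible : ∀ y z → InM y → InM z → S ≡ y ⊕ z → y ≡ 𝟎 ⊎ z ≡ 𝟎
  irreducible y z (_ , ord-y) (_ , ord-z) S≡y⊕z =
    Sum.map (Ordered∧goals₀≡0⇒≡𝟎 ord-y) (Ordered∧goals₀≡0⇒≡𝟎 ord-z)
      (m+n≡1⇒m≡0⊎n≡0 (goals y fzero) (goals z fzero) (begin
        goals y fzero + goals z fzero  ≡⟨ goals-⊕ y z fzero ⟨
        goals (y ⊕ z) fzero            ≡⟨ cong (λ T → goals T fzero) S≡y⊕z ⟨
        goals S fzero                  ≡⟨ g₀≡1 ⟩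
        1                              ∎))

RowOfB : ∀ {n} → ℕ → Fin n → Vec ℕ n → Set
RowOfB i k r = (toℕ k < i × ∃[ j ] (j ≢ k × r ≡ unit j)) ⊎ (i ≤ toℕ k × r ≡ zeros)

RowOfB-sum< : ∀ {n i} {k : Fin n} {r} → RowOfB i k r → toℕ k < i → V.sum r ≡ 1
RowOfB-sum< (inj₁ (_ , j , _ , refl)) _   = sum-unit j
RowOfB-sum< (inj₂ (i≤k , _))          k<i = ⊥-elim (<⇒≱ k<i i≤k)

RowOfB-sum≥ : ∀ {n i} {k : Fin n} {r} → RowOfB i k r → i ≤ toℕ k → V.sum r ≡ 0
RowOfB-sum≥ (inj₁ (k<i , _))         i≤k = ⊥-elim (<⇒≱ k<i i≤k)
RowOfB-sum≥ {n} (inj₂ (_ , refl))    _   = sum-zeros n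

RowsOfB⇒InB : ∀ {n} i (x : Sheet n) → (∀ k → RowOfB i k (lookup x k)) → InB i x
RowsOfB⇒InB i x rows = (diagonal , ordered) , scorers , nonScorers
  where
  diagonal : IsSheet x
  diagonal k with rows k
  ... | inj₁ (_ , j , j≢k , eq) = trans (cong (λ r → lookup r k) eq) (lookup-unit-≢ (j≢k ∘ sym))
  ... | inj₂ (_ , eq)           = trans (cong (λ r → lookup r k) eq) (lookup-replicate k 0)
  ordered : Ordered x
  ordered a b a≤b with toℕ b <? i
  ... | yes b<i = ≤-reflexive (trans (RowOfB-sum< (rows b) b<i) (sym (RowOfB-sum< (rows a) (≤-<-trans a≤b b<i))))
  ... | no  b≮i = subst (_≤ goals x a) (sym (RowOfB-sum≥ (rows b) (≮⇒≥ b≮i))) z≤n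
  scorers : ∀ k → toℕ k < i → ∃[ j ] (j ≢ k × entry x k j ≡ 1 × (∀ j′ → j′ ≢ j → entry x k j′ ≡ 0))
  scorers k k<i with rows k
  ... | inj₁ (_ , j , j≢k , eq) rewrite eq = j , j≢k , lookup-unit j , λ _ → lookup-unit-≢
  ... | inj₂ (i≤k , _)                     = ⊥-elim (<⇒≱ k<i i≤k)
  nonScorers : ∀ k → i ≤ toℕ k → ∀ j → entry x k j ≡ 0
  nonScorers k i≤k j rewrite sum≡0⇒≡zeros (lookup x k) (RowOfB-sum≥ (rows k) i≤k) = lookup-replicate j 0

InB⇒RowsOfB : ∀ {n} i (x : Sheet n) → InB i x → ∀ k → RowOfB i k (lookup x k)
InB⇒RowsOfB i x (_ , scorers , nonScorers) k with toℕ k <? i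
... | yes k<i with scorers k k<i
...   | j , j≢k , x-kj≡1 , others≡0 = inj₁ (k<i , j , j≢k , ≡unit j x-kj≡1 others≡0)
InB⇒RowsOfB i x (_ , scorers , nonScorers) k | no k≮i =
  inj₂ (≮⇒≥ k≮i , ≡zeros (nonScorers k (≮⇒≥ k≮i)))

InB⇒InHB : ∀ {m i} {x : Sheet (suc m)} → 1 ≤ i → InB i x → InHB x
InB⇒InHB {i = i} {x} 1≤i inB@(inM , _) =
  goals₀≡1⇒InHB inM (RowOfB-sum< (InB⇒RowsOfB i x inB fzero) 1≤i)

firstGoalsOf : ∀ {n} → Sheet n → Sheet n
firstGoalsOf = V.map firstGoal

otherGoalsOf : ∀ {n} → Sheet n → Sheet n
otherGoalsOf = V.map otherGoals

≡firstGoalsOf⊕otherGoalsOf : ∀ {n} (x : Sheet n) → x ≡ firstGoalsOf x ⊕ otherGoalsOf x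
≡firstGoalsOf⊕otherGoalsOf x = Pointwise-≡⇒≡ (ext λ k → begin
  lookup x k
    ≡⟨ firstGoal+otherGoals (lookup x k) ⟨
  zipWith _+_ (firstGoal (lookup x k)) (otherGoals (lookup x k))
    ≡⟨ cong₂ (zipWith _+_) (lookup-map k firstGoal x) (lookup-map k otherGoals x) ⟨
  zipWith _+_ (lookup (firstGoalsOf x) k) (lookup (otherGoalsOf x) k)
    ≡⟨ lookup-⊕ (firstGoalsOf x) (otherGoalsOf x) k ⟨
  lookup (firstGoalsOf x ⊕ otherGoalsOf x) k
    ∎)

⊕-identityʳ : ∀ {n} (S : Sheet n) → S ⊕ 𝟎 ≡ S
⊕-identityʳ = zipWith-identityʳ (zipWith-identityʳ +-identityʳ)

goals-firstGoalsOf : ∀ {n} (x : Sheet n) k → goals (firstGoalsOf x) k ≡ goals x k ⊓ 1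
goals-firstGoalsOf x k = trans (cong V.sum (lookup-map k firstGoal x)) (sum-firstGoal (lookup x k))

goals-otherGoalsOf : ∀ {n} (x : Sheet n) k → goals (otherGoalsOf x) k ≡ pred (goals x k)
goals-otherGoalsOf x k = trans (cong V.sum (lookup-map k otherGoals x)) (sum-otherGoals (lookup x k))

n⊓1≡0⇒n≡0 : ∀ n → n ⊓ 1 ≡ 0 → n ≡ 0
n⊓1≡0⇒n≡0 zero _ = refl

InM-firstGoalsOf : ∀ {n} (x : Sheet n) → InM x → InM (firstGoalsOf x)
InM-firstGoalsOf x (diag , ord) =
  IsSheet-⊕⁻ˡ (firstGoalsOf x) (otherGoalsOf x) (subst IsSheet (≡firstGoalsOf⊕otherGoalsOf x) diag) ,
  Ordered-monotone x (firstGoalsOf x) (_⊓ 1) (⊓-monoˡ-≤ 1) (goals-firstGoalsOf x) ord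

InM-otherGoalsOf : ∀ {n} (x : Sheet n) → InM x → InM (otherGoalsOf x)
InM-otherGoalsOf x (diag , ord) =
  IsSheet-⊕⁻ʳ (firstGoalsOf x) (otherGoalsOf x) (subst IsSheet (≡firstGoalsOf⊕otherGoalsOf x) diag) ,
  Ordered-monotone x (otherGoalsOf x) pred pred-mono-≤ (goals-otherGoalsOf x) ord

InHB⇒≡firstGoalsOf : ∀ {n} {x : Sheet n} → InHB x → x ≡ firstGoalsOf x
InHB⇒≡firstGoalsOf {x = x} (inM , x≢𝟎 , irreducible)
  with irreducible (firstGoalsOf x) (otherGoalsOf x) (InM-firstGoalsOf x inM) (InM-otherGoalsOf x inM)
                   (≡firstGoalsOf⊕otherGoalsOf x)
... | inj₁ f≡𝟎 = ⊥-elim (x≢𝟎 (goals≡0⇒≡𝟎 x λ k → n⊓1≡0⇒n≡0 (goals x k) (begin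
  goals x k ⊓ 1             ≡⟨ goals-firstGoalsOf x k ⟨
  goals (firstGoalsOf x) k  ≡⟨ cong (λ T → goals T k) f≡𝟎 ⟩
  goals 𝟎 k                 ≡⟨ goals-𝟎 k ⟩
  0                         ∎)))
... | inj₂ o≡𝟎 = begin
  x                                ≡⟨ ≡firstGoalsOf⊕otherGoalsOf x ⟩
  firstGoalsOf x ⊕ otherGoalsOf x  ≡⟨ cong (firstGoalsOf x ⊕_) o≡𝟎 ⟩
  firstGoalsOf x ⊕ 𝟎               ≡⟨ ⊕-identityʳ (firstGoalsOf x) ⟩
  firstGoalsOf x                   ∎

antitone-nonzero-prefix : ∀ {p} (f : Fin p → ℕ) → (∀ a b → toℕ a ≤ toℕ b → f b ≤ f a) →
  ∃[ i ] (i ≤ p × (∀ k → toℕ k < i → f k ≢ 0) × (∀ k → i ≤ toℕ k → f k ≡ 0))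
antitone-nonzero-prefix {zero} f antitone = 0 , z≤n , (λ ()) , (λ ())
antitone-nonzero-prefix {suc p} f antitone with f fzero in f₀
... | zero  = 0 , z≤n , (λ _ ()) , λ k _ → n≤0⇒n≡0 (subst (f k ≤_) f₀ (antitone fzero k z≤n))
... | suc _ with antitone-nonzero-prefix (f ∘ fsuc) (λ a b a≤b → antitone (fsuc a) (fsuc b) (s≤s a≤b))
...   | i , i≤p , before , after = suc i , s≤s i≤p , before′ , after′
  where
  before′ : ∀ k → toℕ k < suc i → f k ≢ 0
  before′ fzero    _         f₀≡0 with trans (sym f₀) f₀≡0
  ... | ()
  before′ (fsuc k) (s≤s k<i) = before k k<i
  after′ : ∀ k → suc i ≤ toℕ k → f k ≡ 0
  after′ (fsuc k) (s≤s i≤k) = after k i≤k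

unit-row-off-diagonal : ∀ {n} {x : Sheet n} {k j} → IsSheet x → lookup x k ≡ unit j → j ≢ k
unit-row-off-diagonal {x = x} {k} {j} diag row≡unit j≡k with begin
  1                  ≡⟨ lookup-unit j ⟨
  lookup (unit j) j  ≡⟨ cong (λ r → lookup r j) row≡unit ⟨
  entry x k j        ≡⟨ cong (entry x k) j≡k ⟩
  entry x k k        ≡⟨ diag k ⟩
  0                  ∎
... | ()

≡firstGoalsOf⇒InB : ∀ {n} {x : Sheet n} → InM x → x ≢ 𝟎 → x ≡ firstGoalsOf x →
                  ∃[ i ] (1 ≤ i × i ≤ n × InB i x)
≡firstGoalsOf⇒InB {x = x} (diag , ord) x≢𝟎 x≡f with antitone-nonzero-prefix (goals x) ord
... | zero  , _   , _       , idle = ⊥-elim (x≢𝟎 (goals≡0⇒≡𝟎 x λ k → idle k z≤n))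
... | suc i , i≤n , scoring , idle = suc i , s≤s z≤n , i≤n , RowsOfB⇒InB (suc i) x row
  where
  row : ∀ k → RowOfB (suc i) k (lookup x k)
  row k with toℕ k <? suc i
  ... | no k≮i = inj₂ (≮⇒≥ k≮i , sum≡0⇒≡zeros (lookup x k) (idle k (≮⇒≥ k≮i)))
  ... | yes k<i with firstGoal-unit (lookup x k) (scoring k k<i)
  ...   | j , first≡unit = inj₁ (k<i , j , unit-row-off-diagonal {x = x} diag row≡unit , row≡unit)
    where
    row≡unit : lookup x k ≡ unit j
    row≡unit = trans (cong (λ S → lookup S k) x≡f) (trans (lookup-map k firstGoal x) first≡unit)

InHB⇒InB : ∀ {n} (x : Sheet n) → InHB x → ∃[ i ] (1 ≤ i × i ≤ n × InB i x)
InHB⇒InB x hb@(inM , x≢𝟎 , _) = ≡firstGoalsOf⇒InB inM x≢𝟎 (InHB⇒≡firstGoalsOf hb)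

length-cartesianProductWith : ∀ {A B C : Set} (f : A → B → C) xs ys →
  length (cartesianProductWith f xs ys) ≡ length xs * length ys
length-cartesianProductWith f []       ys = refl
length-cartesianProductWith f (x ∷ xs) ys =
  trans (length-++ (map (f x) ys)) (cong₂ _+_ (length-map (f x) ys) (length-cartesianProductWith f xs ys))

module _ {A : Set} where

  choices : ∀ {p} → (Fin p → List A) → List (Vec A p)
  choices {zero}  _ = [ [] ]
  choices {suc p} L = cartesianProductWith _∷_ (L fzero) (choices (L ∘ fsuc))

  ∈-choices⁺ : ∀ {p} {L : Fin p → List A} {v} → (∀ k → lookup v k ∈ L k) → v ∈ choices L
  ∈-choices⁺ {zero}  {v = []}    _ = here refl
  ∈-choices⁺ {suc p} {v = a ∷ v} h = ∈-cartesianProductWith⁺ _∷_ (h fzero) (∈-choices⁺ (h ∘ fsuc))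

  ∈-choices⁻ : ∀ {p} (L : Fin p → List A) {v} → v ∈ choices L → ∀ k → lookup v k ∈ L k
  ∈-choices⁻ {suc p} L v∈ k with ∈-cartesianProductWith⁻ _∷_ (L fzero) (choices (L ∘ fsuc)) v∈
  ∈-choices⁻ {suc p} L v∈ fzero    | _ , _ , a∈ , _  , refl = a∈
  ∈-choices⁻ {suc p} L v∈ (fsuc k) | _ , _ , _  , w∈ , refl = ∈-choices⁻ (L ∘ fsuc) w∈ k

  choices-unique : ∀ {p} (L : Fin p → List A) → (∀ k → Unique (L k)) → Unique (choices L)
  choices-unique {zero}  _ _      = All.[] AllPairs.∷ AllPairs.[]
  choices-unique {suc p} L unique =
    cartesianProductWith⁺ _∷_ ∷-injective (unique fzero) (choices-unique (L ∘ fsuc) (unique ∘ fsuc))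

  length-choices : ∀ {p} (L : Fin p → List A) → length (choices L) ≡ product (List.tabulate (length ∘ L))
  length-choices {zero}  _ = refl
  length-choices {suc p} L =
    trans (length-cartesianProductWith _∷_ (L fzero) (choices (L ∘ fsuc)))
          (cong (length (L fzero) *_) (length-choices (L ∘ fsuc)))

length-concat : ∀ {A : Set} (xss : List (List A)) → length (concat xss) ≡ sum (map length xss)
length-concat []         = refl
length-concat (xs ∷ xss) = trans (length-++ xs) (cong (length xs +_) (length-concat xss))

product-tabulate-prefix : ∀ {p} (f : Fin p → ℕ) a i → i ≤ p →
  (∀ k → toℕ k < i → f k ≡ a) → (∀ k → i ≤ toℕ k → f k ≡ 1) → product (List.tabulate f) ≡ a ^ i
product-tabulate-prefix {zero}  f a zero    z≤n       _      _     = refl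
product-tabulate-prefix {suc p} f a zero    _         _      after
  rewrite after fzero z≤n
        | product-tabulate-prefix (f ∘ fsuc) a zero z≤n (λ _ ()) (λ k _ → after (fsuc k) z≤n) = refl
product-tabulate-prefix {suc p} f a (suc i) (s≤s i≤p) before after
  rewrite before fzero (s≤s z≤n)
        | product-tabulate-prefix (f ∘ fsuc) a i i≤p (λ k k<i → before (fsuc k) (s≤s k<i))
                                                     (λ k i≤k → after (fsuc k) (s≤s i≤k)) = refl

offDiagonalUnits : ∀ {m} → Fin (suc m) → List (Vec ℕ (suc m))
offDiagonalUnits k = List.tabulate (unit ∘ punchIn k)

∈-offDiagonalUnits⁺ : ∀ {m} {k j : Fin (suc m)} → j ≢ k → unit j ∈ offDiagonalUnits k
∈-offDiagonalUnits⁺ {k = k} j≢k =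
  subst (λ j′ → unit j′ ∈ offDiagonalUnits k) (punchIn-punchOut (j≢k ∘ sym)) (∈-tabulate⁺ (punchOut (j≢k ∘ sym)))

∈-offDiagonalUnits⁻ : ∀ {m} {k : Fin (suc m)} {r} → r ∈ offDiagonalUnits k → ∃[ j ] (j ≢ k × r ≡ unit j)
∈-offDiagonalUnits⁻ {k = k} r∈ with ∈-tabulate⁻ r∈
... | j , r≡unit = punchIn k j , punchInᵢ≢i k j , r≡unit

offDiagonalUnits-unique : ∀ {m} (k : Fin (suc m)) → Unique (offDiagonalUnits k)
offDiagonalUnits-unique k = tabulate⁺ (punchIn-injective k _ _ ∘ unit-injective)

rowsOfB : ∀ {m} → ℕ → Fin (suc m) → List (Vec ℕ (suc m))
rowsOfB i k with toℕ k <? i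
... | yes _ = offDiagonalUnits k
... | no  _ = [ zeros ]

∈-rowsOfB⁺ : ∀ {m i} {k : Fin (suc m)} {r} → RowOfB i k r → r ∈ rowsOfB i k
∈-rowsOfB⁺ {i = i} {k} row with toℕ k <? i | row
... | yes _   | inj₁ (_ , j , j≢k , refl) = ∈-offDiagonalUnits⁺ j≢k
... | yes k<i | inj₂ (i≤k , _)           = ⊥-elim (<⇒≱ k<i i≤k)
... | no  k≮i | inj₁ (k<i , _)           = ⊥-elim (k≮i k<i)
... | no  _   | inj₂ (_ , r≡zeros)       = here r≡zeros

∈-rowsOfB⁻ : ∀ {m i} {k : Fin (suc m)} {r} → r ∈ rowsOfB i k → RowOfB i k r
∈-rowsOfB⁻ {i = i} {k} r∈ with toℕ k <? i
... | yes k<i = inj₁ (k<i , ∈-offDiagonalUnits⁻ r∈)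
∈-rowsOfB⁻ (here r≡zeros) | no k≮i = inj₂ (≮⇒≥ k≮i , r≡zeros)

rowsOfB-unique : ∀ {m} i (k : Fin (suc m)) → Unique (rowsOfB i k)
rowsOfB-unique i k with toℕ k <? i
... | yes _ = offDiagonalUnits-unique k
... | no  _ = All.[] AllPairs.∷ AllPairs.[]

length-rowsOfB< : ∀ {m i} (k : Fin (suc m)) → toℕ k < i → length (rowsOfB i k) ≡ m
length-rowsOfB< {i = i} k k<i with toℕ k <? i
... | yes _   = length-tabulate _
... | no  k≮i = ⊥-elim (k≮i k<i)

length-rowsOfB≥ : ∀ {m i} (k : Fin (suc m)) → i ≤ toℕ k → length (rowsOfB i k) ≡ 1
length-rowsOfB≥ {i = i} k i≤k with toℕ k <? i
... | yes k<i = ⊥-elim (<⇒≱ k<i i≤k)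
... | no  _   = refl

sheetsOfB : ∀ {m} → ℕ → List (Sheet (suc m))
sheetsOfB i = choices (rowsOfB i)

∈-sheetsOfB⇔InB : ∀ {m} i (x : Sheet (suc m)) → x ∈ sheetsOfB i ⇔ InB i x
∈-sheetsOfB⇔InB i x = mk⇔
  (λ x∈ → RowsOfB⇒InB i x λ k → ∈-rowsOfB⁻ (∈-choices⁻ (rowsOfB i) x∈ k))
  (λ inB → ∈-choices⁺ λ k → ∈-rowsOfB⁺ (InB⇒RowsOfB i x inB k))

sheetsOfB-unique : ∀ {m} i → Unique (sheetsOfB {m} i)
sheetsOfB-unique i = choices-unique (rowsOfB i) (rowsOfB-unique i)

length-sheetsOfB : ∀ {m i} → i ≤ suc m → length (sheetsOfB {m} i) ≡ m ^ i
length-sheetsOfB {m} {i} i≤n = trans (length-choices (rowsOfB i))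
  (product-tabulate-prefix (length ∘ rowsOfB i) m i i≤n length-rowsOfB< length-rowsOfB≥)

InB-disjoint : ∀ {n i j} (x : Sheet n) → i < j → j ≤ n → InB i x → InB j x → ⊥
InB-disjoint {i = i} {j} x i<j j≤n inB-i inB-j
  with trans (sym (RowOfB-sum≥ (InB⇒RowsOfB i x inB-i k) (≤-reflexive (sym k≡i))))
             (RowOfB-sum< (InB⇒RowsOfB j x inB-j k) (subst (_< j) (sym k≡i) i<j))
  where
  k : Fin _
  k = fromℕ< (<-≤-trans i<j j≤n)
  k≡i : toℕ k ≡ i
  k≡i = toℕ-fromℕ< (<-≤-trans i<j j≤n)
... | ()

hbList : ∀ m → List (Sheet (suc m))
hbList m = concat (map (sheetsOfB ∘ suc) (upTo (suc m)))

∈-hbList⇔InB : ∀ m (x : Sheet (suc m)) → x ∈ hbList m ⇔ (∃[ i ] (1 ≤ i × i ≤ suc m × InB i x))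
∈-hbList⇔InB m x = mk⇔ to from
  where
  to : x ∈ hbList m → ∃[ i ] (1 ≤ i × i ≤ suc m × InB i x)
  to x∈ with ∈-concat⁻′ (map (sheetsOfB ∘ suc) (upTo (suc m))) x∈
  ... | _ , x∈xs , xs∈ with ∈-map⁻ (sheetsOfB ∘ suc) xs∈
  ...   | i , i∈ , refl = suc i , s≤s z≤n , ∈-upTo⁻ i∈ , Equivalence.to (∈-sheetsOfB⇔InB (suc i) x) x∈xs
  from : ∃[ i ] (1 ≤ i × i ≤ suc m × InB i x) → x ∈ hbList m
  from (suc i , _ , i<n , inB) =
    ∈-concat⁺′ (Equivalence.from (∈-sheetsOfB⇔InB (suc i) x) inB) (∈-map⁺ (sheetsOfB ∘ suc) (∈-upTo⁺ i<n))

hbList-unique : ∀ m → Unique (hbList m)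
hbList-unique m = subst (Unique ∘ concat) (sym (map-upTo (sheetsOfB ∘ suc) (suc m)))
  (concat⁺ (All.applyUpTo⁺₂ (sheetsOfB ∘ suc) (suc m) (sheetsOfB-unique ∘ suc))
           (AllPairs.applyUpTo⁺₁ (sheetsOfB ∘ suc) (suc m) disjoint))
  where
  disjoint : ∀ {i j} → i < j → j < suc m → ∀ {x} → ¬ (x ∈ sheetsOfB (suc i) × x ∈ sheetsOfB (suc j))
  disjoint i<j j<n {x} (x∈i , x∈j) = InB-disjoint x (s≤s i<j) j<n
    (Equivalence.to (∈-sheetsOfB⇔InB _ x) x∈i) (Equivalence.to (∈-sheetsOfB⇔InB _ x) x∈j)

length-hbList : ∀ m → length (hbList m) ≡ hbCount (suc m)
length-hbList m = begin
  length (hbList m)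
    ≡⟨ length-concat (map (sheetsOfB {m} ∘ suc) (upTo (suc m))) ⟩
  sum (map length (map (sheetsOfB {m} ∘ suc) (upTo (suc m))))
    ≡⟨ cong sum (map-∘ (upTo (suc m))) ⟨
  sum (map (length ∘ sheetsOfB {m} ∘ suc) (upTo (suc m)))
    ≡⟨ cong sum (map-cong-local (All.map (length-sheetsOfB {m}) (All.all-upTo (suc m)))) ⟩
  hbCount (suc m)
    ∎

theorem4p1 : ∀ (n : ℕ) → 1 ≤ n →
    (∀ (x : Sheet n) → InHB x ⇔ (∃[ i ] (1 ≤ i × i ≤ n × InB i x)))
    × (Σ (List (Sheet n)) λ L → Unique L × (∀ (x : Sheet n) → x ∈ L ⇔ InHB x)
         × length L ≡ hbCount n)
theorem4p1 (suc m) _ = InHB⇔InB , hbList m , hbList-unique m , ∈-hbList⇔InHB , length-hbList m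
  where
  InHB⇔InB : ∀ (x : Sheet (suc m)) → InHB x ⇔ (∃[ i ] (1 ≤ i × i ≤ suc m × InB i x))
  InHB⇔InB x = mk⇔ (InHB⇒InB x) (λ (_ , 1≤i , _ , inB) → InB⇒InHB 1≤i inB)
  ∈-hbList⇔InHB : ∀ (x : Sheet (suc m)) → x ∈ hbList m ⇔ InHB x
  ∈-hbList⇔InHB x = ⇔.trans (∈-hbList⇔InB m x) (⇔.sym (InHB⇔InB x))
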